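{- Let $n\ge2$, $p\in(0,1)$, and let $(X_t^S)$, $(X_t^D)$ be the SARPZF and DARPZF Markov chains on $K_n$ with reversion probability $p$, with $X_t$ the number of blue vertices, and let $q(n,b)=1-(1-\tfrac{b}{n-1})^b$. Then for $0\le b\le n$, \[\mathbf{E}_b[X_1^S]=(1-p)\big(b+(n-b)q(n,b)\big)\quad\text{and}\quad\mathbf{E}_b[X_1^D]=\mathbf{E}_b[X_1^S]+np\,q(n,b)^{n-b}.\]
   Context: On a graph with blue set $B$, SARPZF with reversion probability $p$: Phase 1: each blue vertex $u$ independently attempts to force each white neighbor $w$ with success probability $|N[u]\cap B|/\deg u$ ($N[u]$ closed neighborhood); a white vertex becomes blue if some attempt succeeds, giving $B'$. Phase 2: each vertex of $B'$ independently turns white with probability $p$. DARPZF is identical except no reversion when $B'$ is the whole vertex set. $\mathbf{E}_b$ denotes expectation given $X_0=b$; $0^0=1$.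
   Formalization: The reversion probability p ranges over the rationals in $(0,1)$. -}

module Defs where

open import Data.Nat as ℕ using (ℕ; zero; suc)
open import Data.Integer using (+_)
open import Data.Rational using (ℚ; 0ℚ; 1ℚ; _+_; _*_; _-_; _/_)
open import Data.Bool using (Bool; true; false; _∧_; _∨_; not; if_then_else_)
open import Data.Fin using (Fin; zero; suc)
open import Data.Fin.Properties using (_≟_)
open import Data.Vec using (Vec; []; _∷_; lookup; tabulate; foldr)
open import Data.Fin.Subset using (Subset; ∣_∣)
open import Data.List using (List; []; _∷_; concatMap; map)
open import Data.Product using (_×_; _,_)
open import Relation.Nullary.Decidable using (⌊_⌋)

-- a / d as a rational, with the (unused) convention a / 0 = 0
frac : ℕ → ℕ → ℚ
frac a zero    = 0ℚ
frac a (suc d) = (+ a) / suc d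

-- natural-number powers of rationals; x ^ 0 = 1 (so 0^0 = 1)
_^ℚ_ : ℚ → ℕ → ℚ
x ^ℚ zero  = 1ℚ
x ^ℚ suc k = x * (x ^ℚ k)

Dist : Set → Set
Dist A = List (ℚ × A)

return : {A : Set} → A → Dist A
return a = (1ℚ , a) ∷ []

_>>=_ : {A B : Set} → Dist A → (A → Dist B) → Dist B
d >>= f = concatMap (λ { (r , a) → map (λ { (s , b) → (r * s , b) }) (f a) }) d

bernoulli : ℚ → Dist Bool
bernoulli r = (r , true) ∷ (1ℚ - r , false) ∷ []

indep : {A : Set} (n : ℕ) → (Fin n → Dist A) → Dist (Vec A n)
indep zero    f = return []
indep (suc n) f = f zero >>= λ a → indep n (λ i → f (suc i)) >>= λ v → return (a ∷ v)

𝔼 : {A : Set} → (A → ℚ) → Dist A → ℚ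
𝔼 g []             = 0ℚ
𝔼 g ((r , a) ∷ d) = r * g a + 𝔼 g d

Graph : ℕ → Set
Graph n = Fin n → Fin n → Bool

complete : (n : ℕ) → Graph n
complete n i j = not ⌊ i ≟ j ⌋

count : {n : ℕ} → Vec Bool n → ℕ
count = foldr _ (λ b k → if b then suc k else k) 0

deg : {n : ℕ} → Graph n → Fin n → ℕ
deg G u = count (tabulate (G u))

closedNbrBlue : {n : ℕ} → Graph n → Subset n → Fin n → ℕ
closedNbrBlue G B u =
  count (tabulate (λ v → lookup B v ∧ (G u v ∨ ⌊ u ≟ v ⌋)))

forceProb : {n : ℕ} → Graph n → Subset n → Fin n → ℚ
forceProb G B u = frac (closedNbrBlue G B u) (deg G u)

anyV : {n : ℕ} → Vec Bool n → Bool
anyV = foldr _ _∨_ false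

phase1 : {n : ℕ} → Graph n → Subset n → Dist (Subset n)
phase1 {n} G B = indep n vertex
  where
  attempt : Fin n → Fin n → Dist Bool
  attempt w u = if lookup B u ∧ G u w then bernoulli (forceProb G B u) else return false
  vertex : Fin n → Dist Bool
  vertex w = if lookup B w then return true
             else (indep n (attempt w) >>= λ v → return (anyV v))

phase2 : {n : ℕ} → ℚ → Subset n → Dist (Subset n)
phase2 {n} p B' = indep n λ v →
  if lookup B' v then (bernoulli p >>= λ r → return (not r)) else return false

allBlue : {n : ℕ} → Subset n → Bool
allBlue = foldr _ _∧_ true

sarpzfStep : {n : ℕ} → Graph n → ℚ → Subset n → Dist (Subset n)
sarpzfStep G p B = phase1 G B >>= phase2 p

darpzfStep : {n : ℕ} → Graph n → ℚ → Subset n → Dist (Subset n)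
darpzfStep G p B = phase1 G B >>= λ B' →
  if allBlue B' then return B' else phase2 p B'

blueCount : {n : ℕ} → Subset n → ℚ
blueCount B = (+ ∣ B ∣) / 1

q : ℕ → ℕ → ℚ
q n b = 1ℚ - ((1ℚ - frac b (n ℕ.∸ 1)) ^ℚ b)

-- On K_n every blue vertex forces with probability b/(n-1), so a white vertex
-- stays white with probability (1 - b/(n-1))^b and turns blue with probability
-- q(n,b), independently of the other white vertices.  Linearity of expectation
-- over the independent coordinates gives the expected number of blue vertices
-- after phase 1, and phase 2 scales it by 1 - p.  DARPZF differs from SARPZF
-- only on the event that every vertex is blue after phase 1, of probability
-- q(n,b)^(n-b) by independence, where it keeps all n vertices instead of an
-- expected (1 - p) n.
module Submission where

open import Defs
open import Data.Nat using (ℕ; _≤_; _∸_)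
open import Data.Integer using (+_)
open import Data.Rational using (ℚ; 0ℚ; 1ℚ; _+_; _*_; _-_; _/_; _<_)
open import Data.Fin.Subset using (Subset; ∣_∣)
open import Data.Product using (_×_)
open import Relation.Binary.PropositionalEquality using (_≡_)

open import Data.Nat using (zero; suc)
open import Data.Nat.Coprimality using (1-coprimeTo)
import Data.Nat.Coprimality as Coprimality
import Data.Integer as ℤ
import Data.Integer.Properties as ℤ
import Data.Rational as ℚ
open import Data.Rational.Properties
  using ( normalize-coprime; +-*-commutativeRing; +-0-monoid; *-1-monoid
        ; +-identityˡ; +-identityʳ; *-identityˡ; *-identityʳ; *-zeroˡ; *-zeroʳ
        ; +-assoc; *-assoc; *-comm )
open import Algebra.Properties.Monoid.Sum +-0-monoid
  using () renaming (sum to ∑; sum-cong-≗ to ∑-cong)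
open import Algebra.Properties.Monoid.Sum *-1-monoid
  using () renaming (sum to ∏; sum-cong-≗ to ∏-cong; sum-replicate-zero to ∏-replicate-1)
open import Data.Bool using (Bool; true; false; _∧_; not; if_then_else_)
open import Data.Bool.Properties using (∨-inverseˡ; ∧-identityʳ; ∧-zeroʳ)
open import Data.Fin using (Fin; zero; suc)
open import Data.Fin.Properties using (_≟_)
open import Data.Fin.Subset using (∁)
open import Data.Fin.Subset.Properties using (∣∁p∣≡n∸∣p∣)
open import Data.Vec using (Vec; []; _∷_; lookup; tabulate)
open import Data.Vec.Properties using (tabulate-cong; tabulate∘lookup)
open import Data.List using ([]; _∷_; _++_; map)
open import Data.Product using (_,_)
open import Function using (_∘_)
open import Relation.Nullary.Decidable using (⌊_⌋; dec⇒maybe; yes; no)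
open import Relation.Binary.PropositionalEquality
  using (refl; sym; trans; cong; cong₂; module ≡-Reasoning)
open import Tactic.RingSolver using (solve-∀)
open import Tactic.RingSolver.Core.AlmostCommutativeRing
  using (AlmostCommutativeRing; fromCommutativeRing)
open import Level using (0ℓ)

open ≡-Reasoning

ℚ-ring : AlmostCommutativeRing 0ℓ 0ℓ
ℚ-ring = fromCommutativeRing +-*-commutativeRing (λ x → dec⇒maybe (0ℚ ℚ.≟ x))

fromℕ : ℕ → ℚ
fromℕ k = (+ k) / 1

fromℕ-suc : ∀ k → fromℕ (suc k) ≡ 1ℚ + fromℕ k
fromℕ-suc k rewrite normalize-coprime (Coprimality.sym (1-coprimeTo k)) =
  cong (λ z → (+ 1 ℤ.+ z) / 1) (sym (ℤ.*-identityʳ (+ k)))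

𝟙 : Bool → ℚ
𝟙 true  = 1ℚ
𝟙 false = 0ℚ

mass : {A : Set} → Dist A → ℚ
mass = 𝔼 (λ _ → 1ℚ)

𝔼-cong : {A : Set} {g h : A → ℚ} (d : Dist A) → (∀ a → g a ≡ h a) → 𝔼 g d ≡ 𝔼 h d
𝔼-cong []            g≗h = refl
𝔼-cong ((r , a) ∷ d) g≗h = cong₂ (λ x y → r * x + y) (g≗h a) (𝔼-cong d g≗h)

𝔼-return : {A : Set} (g : A → ℚ) (a : A) → 𝔼 g (return a) ≡ g a
𝔼-return g a = trans (+-identityʳ _) (*-identityˡ (g a))

𝔼-++ : {A : Set} (g : A → ℚ) (xs ys : Dist A) → 𝔼 g (xs ++ ys) ≡ 𝔼 g xs + 𝔼 g ys
𝔼-++ g []             ys = sym (+-identityˡ (𝔼 g ys))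
𝔼-++ g ((r , a) ∷ xs) ys = begin
  r * g a + 𝔼 g (xs ++ ys)       ≡⟨ cong (_+_ (r * g a)) (𝔼-++ g xs ys) ⟩
  r * g a + (𝔼 g xs + 𝔼 g ys)    ≡⟨ sym (+-assoc (r * g a) (𝔼 g xs) (𝔼 g ys)) ⟩
  r * g a + 𝔼 g xs + 𝔼 g ys      ∎

-- The weight-rescaling function is taken as a parameter because the
-- pattern-matching lambda inside _>>=_ cannot be named from outside.
𝔼-map-scale : {A : Set} (g : A → ℚ) (r : ℚ) (h : ℚ × A → ℚ × A) →
  (∀ s a → h (s , a) ≡ (r * s , a)) → (d : Dist A) → 𝔼 g (map h d) ≡ r * 𝔼 g d
𝔼-map-scale g r h h-scales []            = sym (*-zeroʳ r)
𝔼-map-scale g r h h-scales ((s , a) ∷ d) rewrite h-scales s a = begin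
  r * s * g a + 𝔼 g (map h d)   ≡⟨ cong (_+_ (r * s * g a)) (𝔼-map-scale g r h h-scales d) ⟩
  r * s * g a + r * 𝔼 g d       ≡⟨ rearrange r s (g a) (𝔼 g d) ⟩
  r * (s * g a + 𝔼 g d)         ∎
  where
  rearrange : ∀ r s x e → r * s * x + r * e ≡ r * (s * x + e)
  rearrange = solve-∀ ℚ-ring

𝔼->>= : {A B : Set} (g : B → ℚ) (d : Dist A) (f : A → Dist B) →
  𝔼 g (d >>= f) ≡ 𝔼 (λ a → 𝔼 g (f a)) d
𝔼->>= g []            f = refl
𝔼->>= g ((r , a) ∷ d) f =
  trans (𝔼-++ g (map _ (f a)) (d >>= f))
        (cong₂ _+_ (𝔼-map-scale g r _ (λ s b → refl) (f a)) (𝔼->>= g d f))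

𝔼->>=-return : {A B : Set} (g : B → ℚ) (d : Dist A) (k : A → B) →
  𝔼 g (d >>= (return ∘ k)) ≡ 𝔼 (g ∘ k) d
𝔼->>=-return g d k = trans (𝔼->>= g d (return ∘ k)) (𝔼-cong d (λ a → 𝔼-return g (k a)))

𝔼-*ˡ : {A : Set} (c : ℚ) (g : A → ℚ) (d : Dist A) → 𝔼 (λ a → c * g a) d ≡ c * 𝔼 g d
𝔼-*ˡ c g []            = sym (*-zeroʳ c)
𝔼-*ˡ c g ((r , a) ∷ d) rewrite 𝔼-*ˡ c g d = rearrange r c (g a) (𝔼 g d)
  where
  rearrange : ∀ r c x e → r * (c * x) + c * e ≡ c * (r * x + e)
  rearrange = solve-∀ ℚ-ring

𝔼-+ : {A : Set} (g h : A → ℚ) (d : Dist A) → 𝔼 (λ a → g a + h a) d ≡ 𝔼 g d + 𝔼 h d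
𝔼-+ g h []            = refl
𝔼-+ g h ((r , a) ∷ d) rewrite 𝔼-+ g h d = rearrange r (g a) (h a) (𝔼 g d) (𝔼 h d)
  where
  rearrange : ∀ r x y e f → r * (x + y) + (e + f) ≡ (r * x + e) + (r * y + f)
  rearrange = solve-∀ ℚ-ring

𝔼-- : {A : Set} (g h : A → ℚ) (d : Dist A) → 𝔼 (λ a → g a - h a) d ≡ 𝔼 g d - 𝔼 h d
𝔼-- g h []            = refl
𝔼-- g h ((r , a) ∷ d) rewrite 𝔼-- g h d = rearrange r (g a) (h a) (𝔼 g d) (𝔼 h d)
  where
  rearrange : ∀ r x y e f → r * (x - y) + (e - f) ≡ (r * x + e) - (r * y + f)
  rearrange = solve-∀ ℚ-ring

𝔼-const : {A : Set} (c : ℚ) (d : Dist A) → mass d ≡ 1ℚ → 𝔼 (λ _ → c) d ≡ c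
𝔼-const c d mass≡1 = begin
  𝔼 (λ _ → c) d       ≡⟨ 𝔼-cong d (λ _ → sym (*-identityʳ c)) ⟩
  𝔼 (λ _ → c * 1ℚ) d  ≡⟨ 𝔼-*ˡ c (λ _ → 1ℚ) d ⟩
  c * mass d          ≡⟨ cong (c *_) mass≡1 ⟩
  c * 1ℚ              ≡⟨ *-identityʳ c ⟩
  c                   ∎

mass-bernoulli : (r : ℚ) → mass (bernoulli r) ≡ 1ℚ
mass-bernoulli = identity
  where
  identity : ∀ r → r * 1ℚ + ((1ℚ - r) * 1ℚ + 0ℚ) ≡ 1ℚ
  identity = solve-∀ ℚ-ring

𝔼𝟙∘not-bernoulli : (r : ℚ) → 𝔼 (𝟙 ∘ not) (bernoulli r) ≡ 1ℚ - r
𝔼𝟙∘not-bernoulli = identity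
  where
  identity : ∀ r → r * 0ℚ + ((1ℚ - r) * 1ℚ + 0ℚ) ≡ 1ℚ - r
  identity = solve-∀ ℚ-ring

𝔼-indep-suc : {A : Set} (n : ℕ) (f : Fin (suc n) → Dist A) (g : Vec A (suc n) → ℚ) →
  𝔼 g (indep (suc n) f) ≡ 𝔼 (λ a → 𝔼 (λ v → g (a ∷ v)) (indep n (f ∘ suc))) (f zero)
𝔼-indep-suc n f g = trans (𝔼->>= g (f zero) _)
  (𝔼-cong (f zero) (λ a → 𝔼->>=-return g (indep n (f ∘ suc)) (a ∷_)))

𝔼-indep-∏ : {A : Set} (n : ℕ) (f : Fin n → Dist A) (h : A → ℚ) →
  𝔼 (λ v → ∏ (λ i → h (lookup v i))) (indep n f) ≡ ∏ (λ i → 𝔼 h (f i))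
𝔼-indep-∏ {A} zero f h = 𝔼-return {Vec A 0} (λ _ → 1ℚ) []
𝔼-indep-∏ (suc n) f h = begin
  _                                                   ≡⟨ 𝔼-indep-suc n f _ ⟩
  𝔼 (λ a → 𝔼 (λ v → h a * P v) (indep n (f ∘ suc))) (f zero)
      ≡⟨ 𝔼-cong (f zero) (λ a → trans (𝔼-*ˡ (h a) P (indep n (f ∘ suc))) (cong (h a *_) (𝔼-indep-∏ n (f ∘ suc) h))) ⟩
  𝔼 (λ a → h a * Q) (f zero)                          ≡⟨ 𝔼-cong (f zero) (λ a → *-comm (h a) Q) ⟩
  𝔼 (λ a → Q * h a) (f zero)                          ≡⟨ 𝔼-*ˡ Q h (f zero) ⟩
  Q * 𝔼 h (f zero)                                    ≡⟨ *-comm Q (𝔼 h (f zero)) ⟩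
  𝔼 h (f zero) * Q                                    ∎
  where
  P : Vec _ n → ℚ
  P v = ∏ (λ i → h (lookup v i))
  Q : ℚ
  Q = ∏ (λ i → 𝔼 h (f (suc i)))

mass-indep : {A : Set} (n : ℕ) (f : Fin n → Dist A) → (∀ i → mass (f i) ≡ 1ℚ) →
  mass (indep n f) ≡ 1ℚ
mass-indep n f mass≡1 = begin
  mass (indep n f)                             ≡⟨ 𝔼-cong (indep n f) (λ _ → sym (∏-replicate-1 n)) ⟩
  𝔼 (λ v → ∏ {n} (λ _ → 1ℚ)) (indep n f)      ≡⟨ 𝔼-indep-∏ n f (λ _ → 1ℚ) ⟩
  ∏ (λ i → mass (f i))                         ≡⟨ ∏-cong mass≡1 ⟩
  ∏ {n} (λ _ → 1ℚ)                             ≡⟨ ∏-replicate-1 n ⟩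
  1ℚ                                           ∎

𝔼-indep-∑ : {A : Set} (n : ℕ) (f : Fin n → Dist A) (h : A → ℚ) → (∀ i → mass (f i) ≡ 1ℚ) →
  𝔼 (λ v → ∑ (λ i → h (lookup v i))) (indep n f) ≡ ∑ (λ i → 𝔼 h (f i))
𝔼-indep-∑ {A} zero f h mass≡1 = 𝔼-return {Vec A 0} (λ _ → 0ℚ) []
𝔼-indep-∑ (suc n) f h mass≡1 = begin
  _                                                   ≡⟨ 𝔼-indep-suc n f _ ⟩
  𝔼 (λ a → 𝔼 (λ v → h a + S v) I) (f zero)           ≡⟨ 𝔼-cong (f zero) inner ⟩
  𝔼 (λ a → h a + T) (f zero)                          ≡⟨ 𝔼-+ h (λ _ → T) (f zero) ⟩
  𝔼 h (f zero) + 𝔼 (λ _ → T) (f zero)                 ≡⟨ cong (_+_ (𝔼 h (f zero))) (𝔼-const T (f zero) (mass≡1 zero)) ⟩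
  𝔼 h (f zero) + T                                    ∎
  where
  I = indep n (f ∘ suc)
  S : Vec _ n → ℚ
  S v = ∑ (λ i → h (lookup v i))
  T : ℚ
  T = ∑ (λ i → 𝔼 h (f (suc i)))
  inner : ∀ a → 𝔼 (λ v → h a + S v) I ≡ h a + T
  inner a = trans (𝔼-+ (λ _ → h a) S I)
    (cong₂ _+_ (𝔼-const (h a) I (mass-indep n (f ∘ suc) (mass≡1 ∘ suc)))
               (𝔼-indep-∑ n (f ∘ suc) h (mass≡1 ∘ suc)))

∑-if : {n : ℕ} (B : Subset n) (x y : ℚ) →
  ∑ (λ i → if lookup B i then x else y) ≡ fromℕ ∣ B ∣ * x + fromℕ ∣ ∁ B ∣ * y
∑-if []          x y = identity x y
  where
  identity : ∀ x y → 0ℚ ≡ 0ℚ * x + 0ℚ * y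
  identity = solve-∀ ℚ-ring
∑-if (true ∷ B)  x y rewrite ∑-if B x y | fromℕ-suc ∣ B ∣ =
  rearrange x y (fromℕ ∣ B ∣) (fromℕ ∣ ∁ B ∣)
  where
  rearrange : ∀ x y k l → x + (k * x + l * y) ≡ (1ℚ + k) * x + l * y
  rearrange = solve-∀ ℚ-ring
∑-if (false ∷ B) x y rewrite ∑-if B x y | fromℕ-suc ∣ ∁ B ∣ =
  rearrange x y (fromℕ ∣ B ∣) (fromℕ ∣ ∁ B ∣)
  where
  rearrange : ∀ x y k l → y + (k * x + l * y) ≡ k * x + (1ℚ + l) * y
  rearrange = solve-∀ ℚ-ring

∏-if : {n : ℕ} (B : Subset n) (x y : ℚ) →
  ∏ (λ i → if lookup B i then x else y) ≡ (x ^ℚ ∣ B ∣) * (y ^ℚ ∣ ∁ B ∣)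
∏-if []          x y = refl
∏-if (true ∷ B)  x y rewrite ∏-if B x y = sym (*-assoc x (x ^ℚ ∣ B ∣) (y ^ℚ ∣ ∁ B ∣))
∏-if (false ∷ B) x y rewrite ∏-if B x y = rearrange y (x ^ℚ ∣ B ∣) (y ^ℚ ∣ ∁ B ∣)
  where
  rearrange : ∀ y X Y → y * (X * Y) ≡ X * (y * Y)
  rearrange = solve-∀ ℚ-ring

1^ℚ : (k : ℕ) → 1ℚ ^ℚ k ≡ 1ℚ
1^ℚ zero    = refl
1^ℚ (suc k) rewrite 1^ℚ k = refl

blueCount≡∑𝟙 : {n : ℕ} (B : Subset n) → blueCount B ≡ ∑ (λ i → 𝟙 (lookup B i))
blueCount≡∑𝟙 []          = refl
blueCount≡∑𝟙 (true ∷ B)  = trans (fromℕ-suc ∣ B ∣) (cong (_+_ 1ℚ) (blueCount≡∑𝟙 B))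
blueCount≡∑𝟙 (false ∷ B) = trans (blueCount≡∑𝟙 B) (sym (+-identityˡ _))

𝟙-anyV : {n : ℕ} (v : Vec Bool n) → 𝟙 (anyV v) ≡ 1ℚ - ∏ (λ i → 𝟙 (not (lookup v i)))
𝟙-anyV []          = refl
𝟙-anyV (true ∷ v)  = sym (cong (1ℚ -_) (*-zeroˡ (∏ (λ i → 𝟙 (not (lookup v i))))))
𝟙-anyV (false ∷ v) rewrite 𝟙-anyV v = cong (1ℚ -_) (sym (*-identityˡ (∏ (λ i → 𝟙 (not (lookup v i))))))

𝟙-allBlue : {n : ℕ} (B : Subset n) → 𝟙 (allBlue B) ≡ ∏ (λ i → 𝟙 (lookup B i))
𝟙-allBlue []          = refl
𝟙-allBlue (true ∷ B)  rewrite 𝟙-allBlue B = sym (*-identityˡ (∏ (λ i → 𝟙 (lookup B i))))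
𝟙-allBlue (false ∷ B) = sym (*-zeroˡ (∏ (λ i → 𝟙 (lookup B i))))

allBlue⇒∣B∣≡n : {n : ℕ} (B : Subset n) → allBlue B ≡ true → ∣ B ∣ ≡ n
allBlue⇒∣B∣≡n []          _  = refl
allBlue⇒∣B∣≡n (true ∷ B)  eq = cong suc (allBlue⇒∣B∣≡n B eq)

reversion : {n : ℕ} → ℚ → Subset n → Fin n → Dist Bool
reversion p B' v = if lookup B' v then (bernoulli p >>= λ r → return (not r)) else return false

mass-reversion : {n : ℕ} (p : ℚ) (B' : Subset n) (v : Fin n) → mass (reversion p B' v) ≡ 1ℚ
mass-reversion p B' v with lookup B' v
... | true  = trans (𝔼->>=-return (λ _ → 1ℚ) (bernoulli p) not) (mass-bernoulli p)
... | false = refl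

𝔼𝟙-reversion : {n : ℕ} (p : ℚ) (B' : Subset n) (v : Fin n) →
  𝔼 𝟙 (reversion p B' v) ≡ (if lookup B' v then 1ℚ - p else 0ℚ)
𝔼𝟙-reversion p B' v with lookup B' v
... | true  = trans (𝔼->>=-return 𝟙 (bernoulli p) not) (𝔼𝟙∘not-bernoulli p)
... | false = refl

𝔼-phase2 : {n : ℕ} (p : ℚ) (B' : Subset n) → 𝔼 blueCount (phase2 p B') ≡ (1ℚ - p) * blueCount B'
𝔼-phase2 {n} p B' = begin
  𝔼 blueCount (phase2 p B')                         ≡⟨ 𝔼-cong (phase2 p B') blueCount≡∑𝟙 ⟩
  _                                                 ≡⟨ 𝔼-indep-∑ n (reversion p B') 𝟙 (mass-reversion p B') ⟩
  ∑ (λ v → 𝔼 𝟙 (reversion p B' v))                  ≡⟨ ∑-cong (𝔼𝟙-reversion p B') ⟩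
  _                                                 ≡⟨ ∑-if B' (1ℚ - p) 0ℚ ⟩
  fromℕ ∣ B' ∣ * (1ℚ - p) + fromℕ ∣ ∁ B' ∣ * 0ℚ     ≡⟨ rearrange (fromℕ ∣ B' ∣) (fromℕ ∣ ∁ B' ∣) p ⟩
  (1ℚ - p) * blueCount B'                           ∎
  where
  rearrange : ∀ k l p → k * (1ℚ - p) + l * 0ℚ ≡ (1ℚ - p) * k
  rearrange = solve-∀ ℚ-ring

𝔼-sarpzfStep : {n : ℕ} (G : Graph n) (p : ℚ) (B : Subset n) →
  𝔼 blueCount (sarpzfStep G p B) ≡ (1ℚ - p) * 𝔼 blueCount (phase1 G B)
𝔼-sarpzfStep G p B = begin
  𝔼 blueCount (sarpzfStep G p B)                    ≡⟨ 𝔼->>= blueCount (phase1 G B) (phase2 p) ⟩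
  𝔼 (λ B' → 𝔼 blueCount (phase2 p B')) (phase1 G B) ≡⟨ 𝔼-cong (phase1 G B) (𝔼-phase2 p) ⟩
  𝔼 (λ B' → (1ℚ - p) * blueCount B') (phase1 G B)   ≡⟨ 𝔼-*ˡ (1ℚ - p) blueCount (phase1 G B) ⟩
  (1ℚ - p) * 𝔼 blueCount (phase1 G B)               ∎

𝔼-darpzfStep-after : {n : ℕ} (p : ℚ) (B' : Subset n) →
  𝔼 blueCount (if allBlue B' then return B' else phase2 p B')
    ≡ (1ℚ - p) * blueCount B' + fromℕ n * p * 𝟙 (allBlue B')
𝔼-darpzfStep-after {n} p B' with allBlue B' in all-blue
... | true  rewrite 𝔼-return blueCount B' | allBlue⇒∣B∣≡n B' all-blue = kept p (fromℕ n)
  where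
  kept : ∀ p k → k ≡ (1ℚ - p) * k + k * p * 1ℚ
  kept = solve-∀ ℚ-ring
... | false = trans (𝔼-phase2 p B') (reverted p (blueCount B') (fromℕ n))
  where
  reverted : ∀ p x k → (1ℚ - p) * x ≡ (1ℚ - p) * x + k * p * 0ℚ
  reverted = solve-∀ ℚ-ring

𝔼-darpzfStep : {n : ℕ} (G : Graph n) (p : ℚ) (B : Subset n) →
  𝔼 blueCount (darpzfStep G p B)
    ≡ 𝔼 blueCount (sarpzfStep G p B) + fromℕ n * p * 𝔼 (𝟙 ∘ allBlue) (phase1 G B)
𝔼-darpzfStep {n} G p B = begin
  𝔼 blueCount (darpzfStep G p B)          ≡⟨ 𝔼->>= blueCount P₁ _ ⟩
  _                                       ≡⟨ 𝔼-cong P₁ (𝔼-darpzfStep-after p) ⟩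
  _                                       ≡⟨ 𝔼-+ (λ B' → (1ℚ - p) * blueCount B') (λ B' → fromℕ n * p * 𝟙 (allBlue B')) P₁ ⟩
  _                                       ≡⟨ cong₂ _+_ (trans (𝔼-*ˡ (1ℚ - p) blueCount P₁) (sym (𝔼-sarpzfStep G p B)))
                                                       (𝔼-*ˡ (fromℕ n * p) (𝟙 ∘ allBlue) P₁) ⟩
  𝔼 blueCount (sarpzfStep G p B) + fromℕ n * p * 𝔼 (𝟙 ∘ allBlue) P₁ ∎
  where
  P₁ = phase1 G B

count≡∣∣ : {n : ℕ} (B : Subset n) → count B ≡ ∣ B ∣
count≡∣∣ []          = refl
count≡∣∣ (true ∷ B)  = cong suc (count≡∣∣ B)
count≡∣∣ (false ∷ B) = count≡∣∣ B

closedNbrBlue-complete : {n : ℕ} (B : Subset n) (u : Fin n) →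
  closedNbrBlue (complete n) B u ≡ ∣ B ∣
closedNbrBlue-complete B u = begin
  closedNbrBlue (complete _) B u     ≡⟨ cong count (tabulate-cong λ v →
                                          trans (cong (lookup B v ∧_) (∨-inverseˡ ⌊ u ≟ v ⌋))
                                                (∧-identityʳ (lookup B v))) ⟩
  count (tabulate (lookup B))        ≡⟨ cong count (tabulate∘lookup B) ⟩
  count B                            ≡⟨ count≡∣∣ B ⟩
  ∣ B ∣                              ∎

count-all-true : (m : ℕ) → count (tabulate {n = m} (λ _ → true)) ≡ m
count-all-true zero    = refl
count-all-true (suc m) = cong suc (count-all-true m)

deg-complete : {n : ℕ} (u : Fin n) → deg (complete n) u ≡ n ∸ 1
deg-complete {suc m} zero    = count-all-true m
deg-complete {suc (suc m)} (suc u) =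
  cong suc (trans (cong count (tabulate-cong (λ v → cong not (⌊suc≟suc⌋ u v)))) (deg-complete u))
  where
  ⌊suc≟suc⌋ : ∀ {k} (a b : Fin k) → ⌊ suc a ≟ suc b ⌋ ≡ ⌊ a ≟ b ⌋
  ⌊suc≟suc⌋ a b with a ≟ b
  ... | yes _ = refl
  ... | no  _ = refl

forceProb-complete : {n : ℕ} (B : Subset n) (u : Fin n) →
  forceProb (complete n) B u ≡ frac ∣ B ∣ (n ∸ 1)
forceProb-complete B u = cong₂ frac (closedNbrBlue-complete B u) (deg-complete u)

-- attempt and vertexColour are the local functions of phase1 specialised to
-- K_n, so phase1 (complete n) B is definitionally indep n (vertexColour B).
attempt : {n : ℕ} → Subset n → Fin n → Fin n → Dist Bool
attempt {n} B w u =
  if lookup B u ∧ complete n u w then bernoulli (forceProb (complete n) B u) else return false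

vertexColour : {n : ℕ} → Subset n → Fin n → Dist Bool
vertexColour {n} B w =
  if lookup B w then return true else (indep n (attempt B w) >>= λ v → return (anyV v))

mass-attempt : {n : ℕ} (B : Subset n) (w u : Fin n) → mass (attempt B w u) ≡ 1ℚ
mass-attempt {n} B w u with lookup B u ∧ complete n u w
... | true  = mass-bernoulli (forceProb (complete n) B u)
... | false = refl

-- A white vertex w is no neighbour of itself, so every blue u attempts to force it.
blue∧adjacent-white : {n : ℕ} (B : Subset n) (w u : Fin n) → lookup B w ≡ false →
  lookup B u ∧ complete n u w ≡ lookup B u
blue∧adjacent-white B w u w-white with u ≟ w
... | yes refl = trans (∧-zeroʳ (lookup B u)) (sym w-white)
... | no  _    = ∧-identityʳ (lookup B u)

𝔼-attempt-fails : {n : ℕ} (B : Subset n) (w u : Fin n) → lookup B w ≡ false →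
  𝔼 (𝟙 ∘ not) (attempt B w u) ≡ (if lookup B u then 1ℚ - frac ∣ B ∣ (n ∸ 1) else 1ℚ)
𝔼-attempt-fails {n} B w u w-white rewrite blue∧adjacent-white B w u w-white with lookup B u
... | true  = trans (𝔼𝟙∘not-bernoulli (forceProb (complete n) B u))
                    (cong (1ℚ -_) (forceProb-complete B u))
... | false = refl

mass-vertexColour : {n : ℕ} (B : Subset n) (w : Fin n) → mass (vertexColour B w) ≡ 1ℚ
mass-vertexColour {n} B w with lookup B w
... | true  = refl
... | false = trans (𝔼->>=-return _ (indep n (attempt B w)) anyV)
                    (mass-indep n (attempt B w) (mass-attempt B w))

𝔼𝟙-vertexColour : {n : ℕ} (B : Subset n) (w : Fin n) →
  𝔼 𝟙 (vertexColour B w) ≡ (if lookup B w then 1ℚ else q n ∣ B ∣)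
𝔼𝟙-vertexColour {n} B w with lookup B w in w-colour
... | true  = refl
... | false = begin
  _                                                    ≡⟨ 𝔼->>=-return 𝟙 A anyV ⟩
  𝔼 (𝟙 ∘ anyV) A                                       ≡⟨ 𝔼-cong A 𝟙-anyV ⟩
  _                                                    ≡⟨ 𝔼-- (λ _ → 1ℚ) _ A ⟩
  mass A - 𝔼 (λ v → ∏ (λ i → 𝟙 (not (lookup v i)))) A
      ≡⟨ cong₂ _-_ (mass-indep n (attempt B w) (mass-attempt B w)) (𝔼-indep-∏ n (attempt B w) (𝟙 ∘ not)) ⟩
  1ℚ - ∏ (λ u → 𝔼 (𝟙 ∘ not) (attempt B w u))          ≡⟨ cong (1ℚ -_) (∏-cong (λ u → 𝔼-attempt-fails B w u w-colour)) ⟩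
  _                                                    ≡⟨ cong (1ℚ -_) (∏-if B (1ℚ - frac ∣ B ∣ (n ∸ 1)) 1ℚ) ⟩
  1ℚ - stayWhite ^ℚ ∣ B ∣ * (1ℚ ^ℚ ∣ ∁ B ∣)            ≡⟨ cong (λ z → 1ℚ - stayWhite ^ℚ ∣ B ∣ * z) (1^ℚ ∣ ∁ B ∣) ⟩
  1ℚ - stayWhite ^ℚ ∣ B ∣ * 1ℚ                         ≡⟨ cong (1ℚ -_) (*-identityʳ (stayWhite ^ℚ ∣ B ∣)) ⟩
  q n ∣ B ∣                                            ∎
  where
  A = indep n (attempt B w)
  stayWhite = 1ℚ - frac ∣ B ∣ (n ∸ 1)

𝔼-phase1-complete : {n : ℕ} (B : Subset n) →
  𝔼 blueCount (phase1 (complete n) B) ≡ (fromℕ ∣ B ∣) + fromℕ (n ∸ ∣ B ∣) * q n ∣ B ∣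
𝔼-phase1-complete {n} B = begin
  𝔼 blueCount (indep n (vertexColour B))        ≡⟨ 𝔼-cong (indep n (vertexColour B)) blueCount≡∑𝟙 ⟩
  _                                             ≡⟨ 𝔼-indep-∑ n (vertexColour B) 𝟙 (mass-vertexColour B) ⟩
  _                                             ≡⟨ ∑-cong (𝔼𝟙-vertexColour B) ⟩
  _                                             ≡⟨ ∑-if B 1ℚ (q n ∣ B ∣) ⟩
  fromℕ ∣ B ∣ * 1ℚ + fromℕ ∣ ∁ B ∣ * q n ∣ B ∣  ≡⟨ cong₂ (λ x y → x + fromℕ y * q n ∣ B ∣)
                                                         (*-identityʳ (fromℕ ∣ B ∣)) (∣∁p∣≡n∸∣p∣ B) ⟩
  (fromℕ ∣ B ∣) + fromℕ (n ∸ ∣ B ∣) * q n ∣ B ∣ ∎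

ℙ-phase1-complete-allBlue : {n : ℕ} (B : Subset n) →
  𝔼 (𝟙 ∘ allBlue) (phase1 (complete n) B) ≡ q n ∣ B ∣ ^ℚ (n ∸ ∣ B ∣)
ℙ-phase1-complete-allBlue {n} B = begin
  𝔼 (𝟙 ∘ allBlue) (indep n (vertexColour B))      ≡⟨ 𝔼-cong (indep n (vertexColour B)) 𝟙-allBlue ⟩
  _                                               ≡⟨ 𝔼-indep-∏ n (vertexColour B) 𝟙 ⟩
  _                                               ≡⟨ ∏-cong (𝔼𝟙-vertexColour B) ⟩
  _                                               ≡⟨ ∏-if B 1ℚ (q n ∣ B ∣) ⟩
  1ℚ ^ℚ ∣ B ∣ * q n ∣ B ∣ ^ℚ ∣ ∁ B ∣              ≡⟨ cong₂ (λ x y → x * q n ∣ B ∣ ^ℚ y) (1^ℚ ∣ B ∣) (∣∁p∣≡n∸∣p∣ B) ⟩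
  1ℚ * q n ∣ B ∣ ^ℚ (n ∸ ∣ B ∣)                   ≡⟨ *-identityˡ (q n ∣ B ∣ ^ℚ (n ∸ ∣ B ∣)) ⟩
  q n ∣ B ∣ ^ℚ (n ∸ ∣ B ∣)                        ∎

-- The hypotheses on n, p and b are not used: the identities hold for every
-- p ∈ ℚ and every n, for n = 1 through the junk value frac b 0 = 0.
theorem4p7 : (n : ℕ) → 2 ≤ n → (p : ℚ) → 0ℚ < p → p < 1ℚ →
    (b : ℕ) → b ≤ n → (B : Subset n) → ∣ B ∣ ≡ b →
      (𝔼 blueCount (sarpzfStep (complete n) p B)
         ≡ (1ℚ - p) * ((+ b) / 1 + (+ (n ∸ b)) / 1 * q n b))
      × (𝔼 blueCount (darpzfStep (complete n) p B)
         ≡ 𝔼 blueCount (sarpzfStep (complete n) p B)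
           + (+ n) / 1 * p * (q n b ^ℚ (n ∸ b)))
theorem4p7 n _ p _ _ _ _ B refl =
    trans (𝔼-sarpzfStep (complete n) p B) (cong ((1ℚ - p) *_) (𝔼-phase1-complete B))
  , trans (𝔼-darpzfStep (complete n) p B)
          (cong (λ x → 𝔼 blueCount (sarpzfStep (complete n) p B) + fromℕ n * p * x)
                (ℙ-phase1-complete-allBlue B))
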